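{- Let $G$ be a graph and $H$ a subgraph of $\overline{L(G)}$ having $k$ edges. Then there exists an interval-order subgraph of $\overline{L(G)}$ containing at least $\frac{k}{3}$ edges of $H$.
   Context: Graphs are finite and simple. $L(G)$ is the line graph of $G$ and $\overline{L(G)}$ its complement. An interval-order graph is the complement of an interval graph (intersection graph of finitely many closed real intervals); an interval-order subgraph of a graph $X$ is a graph $(V(X),F)$ with $F\subseteq E(X)$ that is an interval-order graph. -}

module Defs where

open import Data.Nat using (ℕ; _<ᵇ_)
open import Data.Bool using (Bool; true; false; _∧_; not)
open import Data.Fin using (Fin; toℕ)
open import Data.Fin.Properties using (_≟_)
open import Data.List using (List; length; filterᵇ; cartesianProduct; lookup)
open import Data.List.Base using (allFin)
open import Data.Product using (_×_; _,_; proj₁; proj₂; Σ)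
open import Relation.Nullary.Decidable using (⌊_⌋)
open import Relation.Binary.PropositionalEquality using (_≡_)
open import Data.Rational using (ℚ) renaming (_≤_ to _≤ℚ_; _<_ to _<ℚ_)
open import Data.Sum using (_⊎_)
open import Function.Bundles using (_⇔_)
open import Relation.Nullary using (¬_)

record Graph (n : ℕ) : Set where
  field
    adj    : Fin n → Fin n → Bool
    sym    : ∀ i j → adj i j ≡ adj j i
    irrefl : ∀ i → adj i i ≡ false
open Graph public

pairs< : (n : ℕ) → List (Fin n × Fin n)
pairs< n = filterᵇ (λ p → toℕ (proj₁ p) <ᵇ toℕ (proj₂ p))
                   (cartesianProduct (allFin n) (allFin n))

edgeList : {n : ℕ} → (Fin n → Fin n → Bool) → List (Fin n × Fin n)
edgeList {n} r = filterᵇ (λ p → r (proj₁ p) (proj₂ p)) (pairs< n)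

∣E∣ : {n : ℕ} → Graph n → ℕ
∣E∣ G = length (edgeList (adj G))

commonEdges : {n : ℕ} → Graph n → Graph n → ℕ
commonEdges G H = length (edgeList (λ i j → adj G i j ∧ adj H i j))

-- Line graph data: the vertices of L(G) are the edges of G, i.e. Fin m
-- where m is the number of edges of G, indexing the edge list of G.
LV : {n : ℕ} → Graph n → ℕ
LV G = ∣E∣ G

endpoints : {n : ℕ} (G : Graph n) → Fin (LV G) → Fin n × Fin n
endpoints G e = lookup (edgeList (adj G)) e

eqᵇ : {n : ℕ} → Fin n → Fin n → Bool
eqᵇ a b = ⌊ a ≟ b ⌋

-- Two edges of G are adjacent in the complement of L(G) iff they are
-- distinct and share no endpoint (sharing no endpoint already forces
-- distinctness).
coLineAdj : {n : ℕ} (G : Graph n) → Fin (LV G) → Fin (LV G) → Bool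
coLineAdj G e f with endpoints G e | endpoints G f
... | (a , b) | (c , d) =
  not (eqᵇ a c) ∧ not (eqᵇ a d) ∧ not (eqᵇ b c) ∧ not (eqᵇ b d)

_⊆E_ : {n : ℕ} → Graph n → Graph n → Set
H ⊆E X = ∀ i j → adj H i j ≡ true → adj X i j ≡ true

record Interval : Set where
  field
    lo  : ℚ
    hi  : ℚ
    lo≤hi : lo ≤ℚ hi
open Interval public

Disjoint : Interval → Interval → Set
Disjoint I J = (hi I <ℚ lo J) ⊎ (hi J <ℚ lo I)

-- Interval-order graph: complement of an interval graph, i.e. there are
-- closed intervals I_v such that for distinct u, v, uv is an edge iff
-- I_u and I_v are disjoint.
IsIntervalOrder : {n : ℕ} → Graph n → Set
IsIntervalOrder {n} F =
  Σ (Fin n → Interval) λ I →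
    ∀ u v → ¬ (u ≡ v) → (adj F u v ≡ true ⇔ Disjoint (I u) (I v))

SubCoL : {n : ℕ} (G : Graph n) → Graph (LV G) → Set
SubCoL G H = ∀ e f → adj H e f ≡ true → coLineAdj G e f ≡ true

-- Order the vertices of G by an injective labelling x. Each edge ab of G becomes the interval
-- between the labels of a and b, and joining two edges of G when their intervals are disjoint
-- gives an interval-order subgraph F_x of the complement of L(G): disjoint intervals share no
-- endpoint. The four endpoints of an edge {ab, cd} of H are distinct, and of the three pairings
-- ab|cd, ac|bd, ad|cb of four distinct numbers at least one is separated. Relabelling by the
-- transposition of b and c (of b and d) permutes the labellings and turns ab|cd into ac|bd
-- (into ad|cb), so ab|cd is separated by at least a third of the labellings. Averaging over all
-- labellings, some F_x contains at least a third of the edges of H. Orderings are realised as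
-- the injective maps Fin n → Fin n, and averages as sums over all maps weighted by injectivity.
module Submission where

open import Defs hiding (sym)
open import Data.Bool using (Bool; true; false; T; not; _∧_; _∨_)
open import Data.Bool.Properties using (T-∧; ∨-comm; ∨-zeroʳ; ∧-identityʳ)
open import Data.Empty using (⊥)
open import Data.Fin using (Fin; zero; suc; toℕ; combine; finToFun; funToFin)
open import Data.Fin.Permutation using (Permutation′; permutation; transpose; _⟨$⟩ʳ_; _⟨$⟩ˡ_; inverseˡ; inverseʳ)
open import Data.Fin.Properties using (_≟_; all?; any?; toℕ-injective; finToFun-funToFin; funToFin-finToFin)
import Data.Integer as ℤ
import Data.Integer.Properties as ℤ
open import Data.List using ([]; _∷_; length; filterᵇ; lookup)
open import Data.List.Membership.Propositional.Properties using (∈-lookup)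
import Data.List.Relation.Unary.All as All
open import Data.List.Relation.Unary.All.Properties using (all-filter)
open import Data.Nat using (ℕ; zero; suc; _+_; _*_; _^_; _⊔_; _⊓_; _≤_; _<_; _<ᵇ_; z≤n; s≤s; s≤s⁻¹)
open import Data.Nat.Properties
  using ( ≤-trans; <-trans; <-cmp; _<?_; ≤⇒≯; <⇒≯; <⇒≱; ≮⇒≥; m≤m+n; m≤n+m; m<n+m; +-mono-≤; +-identityʳ
        ; *-comm; *-suc; *-cancelˡ-<; <ᵇ⇒<; <⇒<ᵇ; <ᵇ-reflects-<; ⊓-glb; ⊔-pres-<m
        ; m≤m⊔n; m≤n⊔m; m⊓n≤m; m⊓n≤n; m⊓n≤m⊔n; m⊔n<o⇒m<o; m⊔n<o⇒n<o; m<n⊓o⇒m<n; m<n⊓o⇒m<o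
        ; +-*-semiring; *-commutativeSemigroup; module ≤-Reasoning )
open import Algebra.Properties.CommutativeSemigroup *-commutativeSemigroup using (x∙yz≈y∙xz)
open import Algebra.Properties.Semiring.Sum +-*-semiring
  using (sum; sum-syntax; sum-cong-≗; ∑-distrib-+; ∑-comm; ∑-permute; *-distribˡ-sum; *-distribʳ-sum)
open import Data.Product using (Σ; ∃-syntax; _×_; _,_; proj₁; proj₂)
import Data.Product as Product
open import Data.Rational using (ℚ; *≤*; *<*) renaming (_≤_ to _≤ℚ_; _<_ to _<ℚ_)
open import Data.Rational.Literals using (fromℤ)
open import Data.Sum using (inj₁; inj₂)
open import Data.Vec.Functional using (Vector)
open import Function.Base using (_∘_; id)
open import Function.Bundles using (Equivalence; _⇔_; mk⇔)
open import Function.Definitions using (Congruent; Injective)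
open import Relation.Binary.Definitions using (tri<; tri≈; tri>)
open import Relation.Binary.PropositionalEquality
open import Relation.Nullary using (Dec; yes; no; does; ¬_; contradiction)
open import Relation.Nullary.Decidable
  using (T?; map′; _×-dec_; _→-dec_; from-yes; dec-true; dec-false; does-⇔)
open import Relation.Nullary.Reflects using (det; fromEquivalence)

⟦_⟧ : Bool → ℕ
⟦ true ⟧  = 1
⟦ false ⟧ = 0

⟦∧⟧ : ∀ a b → ⟦ a ∧ b ⟧ ≡ ⟦ a ⟧ * ⟦ b ⟧
⟦∧⟧ true  b = sym (+-identityʳ ⟦ b ⟧)
⟦∧⟧ false b = refl

⟦⟧≤⟦∧⟧+⟦∧⟧+⟦∧⟧ : ∀ b {s₁ s₂ s₃} → (T b → T (s₁ ∨ s₂ ∨ s₃)) →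
  ⟦ b ⟧ ≤ ⟦ b ∧ s₁ ⟧ + (⟦ b ∧ s₂ ⟧ + ⟦ b ∧ s₃ ⟧)
⟦⟧≤⟦∧⟧+⟦∧⟧+⟦∧⟧ false _ = z≤n
⟦⟧≤⟦∧⟧+⟦∧⟧+⟦∧⟧ true {s₁} {s₂} {s₃} covers = one-holds s₁ s₂ s₃ (covers _)
  where
  one-holds : ∀ a b c → T (a ∨ b ∨ c) → 1 ≤ ⟦ a ⟧ + (⟦ b ⟧ + ⟦ c ⟧)
  one-holds true  _     _    _ = s≤s z≤n
  one-holds false true  _    _ = s≤s z≤n
  one-holds false false true _ = s≤s z≤n

length-filterᵇ : ∀ {A : Set} (P : A → Bool) xs → length (filterᵇ P xs) ≡ ∑[ i < length xs ] ⟦ P (lookup xs i) ⟧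
length-filterᵇ P [] = refl
length-filterᵇ P (x ∷ xs) with P x
... | true  = cong suc (length-filterᵇ P xs)
... | false = length-filterᵇ P xs

∑-mono-≤ : ∀ {n} {f g : Vector ℕ n} → (∀ i → f i ≤ g i) → sum f ≤ sum g
∑-mono-≤ {zero}  f≤g = z≤n
∑-mono-≤ {suc n} f≤g = +-mono-≤ (f≤g zero) (∑-mono-≤ (f≤g ∘ suc))

term≤∑ : ∀ {n} (f : Vector ℕ n) i → f i ≤ sum f
term≤∑ f zero    = m≤m+n (f zero) _
term≤∑ f (suc i) = ≤-trans (term≤∑ (f ∘ suc) i) (m≤n+m _ (f zero))

∑-<⇒∃< : ∀ {n} (f g : Vector ℕ n) → sum f < sum g → ∃[ i ] f i < g i
∑-<⇒∃< f g ∑f<∑g with any? (λ i → f i <? g i)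
... | yes found = found
... | no none = contradiction ∑f<∑g (≤⇒≯ (∑-mono-≤ (λ i → ≮⇒≥ (λ fᵢ<gᵢ → none (i , fᵢ<gᵢ)))))

∑-weighted-≤⇒∃≤ : ∀ {n} (w h : Vector ℕ n) {k} → 0 < sum w →
  k * sum w ≤ sum (λ i → w i * h i) → ∃[ i ] k ≤ h i
∑-weighted-≤⇒∃≤ w h {k} ∑w>0 k∑w≤∑wh =
  Product.map₂ (λ {i} → s≤s⁻¹ ∘ *-cancelˡ-< (w i) k _) (∑-<⇒∃< _ _ ∑wk<∑w[1+h])
  where
  ∑wk<∑w[1+h] : sum (λ i → w i * k) < sum (λ i → w i * suc (h i))
  ∑wk<∑w[1+h] = begin-strict
    sum (λ i → w i * k)                ≡⟨ sum-cong-≗ (λ i → *-comm (w i) k) ⟩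
    sum (λ i → k * w i)                ≡⟨ *-distribˡ-sum k w ⟨
    k * sum w                          ≤⟨ k∑w≤∑wh ⟩
    sum (λ i → w i * h i)              <⟨ m<n+m _ ∑w>0 ⟩
    sum w + sum (λ i → w i * h i)      ≡⟨ ∑-distrib-+ w _ ⟨
    sum (λ i → w i + w i * h i)        ≡⟨ sum-cong-≗ (λ i → *-suc (w i) (h i)) ⟨
    sum (λ i → w i * suc (h i))        ∎
    where open ≤-Reasoning

funToFin-cong : ∀ {n m} {x y : Fin n → Fin m} → x ≗ y → funToFin x ≡ funToFin y
funToFin-cong {zero}  x≗y = refl
funToFin-cong {suc n} x≗y = cong₂ combine (x≗y zero) (funToFin-cong (x≗y ∘ suc))

sumMaps : ∀ {n m} → ((Fin n → Fin m) → ℕ) → ℕ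
sumMaps {n} {m} g = ∑[ k < m ^ n ] g (finToFun k)

module _ {n m : ℕ} {f g : (Fin n → Fin m) → ℕ} where

  sumMaps-cong : (∀ x → f x ≡ g x) → sumMaps f ≡ sumMaps g
  sumMaps-cong f≗g = sum-cong-≗ (f≗g ∘ finToFun {m} {n})

  sumMaps-mono-≤ : (∀ x → f x ≤ g x) → sumMaps f ≤ sumMaps g
  sumMaps-mono-≤ f≤g = ∑-mono-≤ (f≤g ∘ finToFun {m} {n})

sumMaps-+ : ∀ {n m} (f g : (Fin n → Fin m) → ℕ) → sumMaps (λ x → f x + g x) ≡ sumMaps f + sumMaps g
sumMaps-+ {n} {m} f g = ∑-distrib-+ (f ∘ finToFun {m} {n}) (g ∘ finToFun)

term≤sumMaps : ∀ {n m} (g : (Fin n → Fin m) → ℕ) → Congruent _≗_ _≡_ g → ∀ x → g x ≤ sumMaps g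
term≤sumMaps g g-cong x = begin
  g x                        ≡⟨ g-cong (finToFun-funToFin x) ⟨
  g (finToFun (funToFin x))  ≤⟨ term≤∑ (g ∘ finToFun) (funToFin x) ⟩
  sumMaps g                  ∎
  where open ≤-Reasoning

precompose-permutation : ∀ {n m} → Permutation′ n → Permutation′ (m ^ n)
precompose-permutation {n} {m} π = permutation (along (π ⟨$⟩ʳ_)) (along (π ⟨$⟩ˡ_))
  (along-inverse (π ⟨$⟩ʳ_) (π ⟨$⟩ˡ_) (λ _ → inverseˡ π))
  (along-inverse (π ⟨$⟩ˡ_) (π ⟨$⟩ʳ_) (λ _ → inverseʳ π))
  where
  decode : Fin (m ^ n) → Fin n → Fin m
  decode = finToFun
  along : (Fin n → Fin n) → Fin (m ^ n) → Fin (m ^ n)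
  along σ k = funToFin (decode k ∘ σ)
  along-inverse : ∀ σ τ → (∀ i → τ (σ i) ≡ i) → ∀ k → along σ (along τ k) ≡ k
  along-inverse σ τ τσ≗id k = begin
    along σ (along τ k)
      ≡⟨ funToFin-cong (λ i → trans (finToFun-funToFin _ (σ i)) (cong (decode k) (τσ≗id i))) ⟩
    funToFin (decode k)
      ≡⟨ funToFin-finToFin {n} {m} k ⟩
    k ∎
    where open ≡-Reasoning

sumMaps-precompose : ∀ {n m} (π : Permutation′ n) (g : (Fin n → Fin m) → ℕ) → Congruent _≗_ _≡_ g →
  sumMaps g ≡ sumMaps (λ x → g (x ∘ (π ⟨$⟩ʳ_)))
sumMaps-precompose {n} {m} π g g-cong = begin
  sumMaps g
    ≡⟨ ∑-permute (g ∘ decode) (precompose-permutation {m = m} π) ⟩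
  ∑[ k < m ^ n ] g (decode (funToFin (decode k ∘ (π ⟨$⟩ʳ_))))
    ≡⟨ sum-cong-≗ (λ k → g-cong (finToFun-funToFin (decode k ∘ (π ⟨$⟩ʳ_)))) ⟩
  sumMaps (λ x → g (x ∘ (π ⟨$⟩ʳ_)))
    ∎
  where
  open ≡-Reasoning
  decode : Fin (m ^ n) → Fin n → Fin m
  decode = finToFun

module _ {n : ℕ} (i j : Fin n) where

  transpose-matchˡ : transpose i j ⟨$⟩ʳ i ≡ j
  transpose-matchˡ rewrite dec-true (i ≟ i) refl = refl

  transpose-matchʳ : transpose i j ⟨$⟩ʳ j ≡ i
  transpose-matchʳ with j ≟ i
  ... | yes j≡i = j≡i
  ... | no _ rewrite dec-true (j ≟ j) refl = refl

  transpose-other : ∀ {k} → k ≢ i → k ≢ j → transpose i j ⟨$⟩ʳ k ≡ k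
  transpose-other {k} k≢i k≢j rewrite dec-false (k ≟ i) k≢i | dec-false (k ≟ j) k≢j = refl

T-does : ∀ {A : Set} (a? : Dec A) → T (does a?) → A
T-does (yes a) _ = a

injective? : ∀ {n m} (x : Fin n → Fin m) → Dec (Injective _≡_ _≡_ x)
injective? x = map′ (λ inj {i} {j} → inj i j) (λ inj i j → inj)
  (all? λ i → all? λ j → (x i ≟ x j) →-dec (i ≟ j))

injectiveᵇ : ∀ {n m} → (Fin n → Fin m) → Bool
injectiveᵇ x = does (injective? x)

injectiveᵇ-cong : ∀ {n m} → Congruent _≗_ _≡_ (injectiveᵇ {n} {m})
injectiveᵇ-cong {x = x} {y} x≗y = does-⇔ (mk⇔ to from) (injective? x) (injective? y)
  where
  to : Injective _≡_ _≡_ x → Injective _≡_ _≡_ y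
  to inj yᵢ≡yⱼ = inj (trans (x≗y _) (trans yᵢ≡yⱼ (sym (x≗y _))))
  from : Injective _≡_ _≡_ y → Injective _≡_ _≡_ x
  from inj xᵢ≡xⱼ = inj (trans (sym (x≗y _)) (trans xᵢ≡xⱼ (x≗y _)))

injectiveᵇ-precompose : ∀ {n m} (π : Permutation′ n) (x : Fin n → Fin m) →
  injectiveᵇ (x ∘ (π ⟨$⟩ʳ_)) ≡ injectiveᵇ x
injectiveᵇ-precompose π x = does-⇔ (mk⇔ to from) (injective? _) (injective? x)
  where
  to : Injective _≡_ _≡_ (x ∘ (π ⟨$⟩ʳ_)) → Injective _≡_ _≡_ x
  to inj {i} {j} xᵢ≡xⱼ = begin
    i                  ≡⟨ inverseʳ π ⟨
    π ⟨$⟩ʳ (π ⟨$⟩ˡ i)  ≡⟨ cong (π ⟨$⟩ʳ_) (inj (trans (xπ i) (trans xᵢ≡xⱼ (sym (xπ j))))) ⟩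
    π ⟨$⟩ʳ (π ⟨$⟩ˡ j)  ≡⟨ inverseʳ π ⟩
    j                  ∎
    where
    open ≡-Reasoning
    xπ : ∀ k → x (π ⟨$⟩ʳ (π ⟨$⟩ˡ k)) ≡ x k
    xπ k = cong x (inverseʳ π)
  from : Injective _≡_ _≡_ x → Injective _≡_ _≡_ (x ∘ (π ⟨$⟩ʳ_))
  from inj eq = trans (sym (inverseˡ π)) (trans (cong (π ⟨$⟩ˡ_) (inj eq)) (inverseˡ π))

#injections : ℕ → ℕ → ℕ
#injections n m = sumMaps (⟦_⟧ ∘ injectiveᵇ {n} {m})

0<#injections : ∀ n → 0 < #injections n n
0<#injections n = begin
  1                      ≡⟨ cong ⟦_⟧ (dec-true (injective? {n} {n} id) id) ⟨
  ⟦ injectiveᵇ {n} id ⟧  ≤⟨ term≤sumMaps (⟦_⟧ ∘ injectiveᵇ {n} {n}) (cong ⟦_⟧ ∘ injectiveᵇ-cong) id ⟩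
  #injections n n        ∎
  where open ≤-Reasoning

-- Four points on a line

<⇒<ᵇ≡true : ∀ {m n} → m < n → (m <ᵇ n) ≡ true
<⇒<ᵇ≡true m<n = dec-true (T? _) (<⇒<ᵇ m<n)

≮⇒<ᵇ≡false : ∀ {m n} → ¬ m < n → (m <ᵇ n) ≡ false
≮⇒<ᵇ≡false m≮n = dec-false (T? _) (m≮n ∘ <ᵇ⇒< _ _)

<ᵇ≡true⇒< : ∀ m n → (m <ᵇ n) ≡ true → m < n
<ᵇ≡true⇒< m n eq = <ᵇ⇒< m n (subst T (sym eq) _)

<ᵇ≡false⇒≮ : ∀ m n → (m <ᵇ n) ≡ false → ¬ m < n
<ᵇ≡false⇒≮ m n eq m<n = subst T eq (<⇒<ᵇ m<n)

<ᵇ-flip : ∀ {p q} → p ≢ q → (q <ᵇ p) ≡ not (p <ᵇ q)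
<ᵇ-flip {p} {q} p≢q with <-cmp p q
... | tri< p<q _ _ rewrite <⇒<ᵇ≡true p<q = ≮⇒<ᵇ≡false (<⇒≯ p<q)
... | tri≈ _ p≡q _ = contradiction p≡q p≢q
... | tri> _ _ q<p rewrite <⇒<ᵇ≡true q<p | ≮⇒<ᵇ≡false (<⇒≯ q<p) = refl

⊔<ᵇ⊓ : ∀ p q r s → (p ⊔ q <ᵇ r ⊓ s) ≡ (((p <ᵇ r) ∧ (p <ᵇ s)) ∧ ((q <ᵇ r) ∧ (q <ᵇ s)))
⊔<ᵇ⊓ p q r s = det (<ᵇ-reflects-< (p ⊔ q) (r ⊓ s)) (fromEquivalence to from)
  where
  to : T (((p <ᵇ r) ∧ (p <ᵇ s)) ∧ ((q <ᵇ r) ∧ (q <ᵇ s))) → p ⊔ q < r ⊓ s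
  to t
    with pr∧ps , qr∧qs ← Equivalence.to T-∧ t
    with pr , ps ← Equivalence.to T-∧ pr∧ps
    with qr , qs ← Equivalence.to T-∧ qr∧qs
    = ⊓-glb (⊔-pres-<m (<ᵇ⇒< p r pr) (<ᵇ⇒< q r qr)) (⊔-pres-<m (<ᵇ⇒< p s ps) (<ᵇ⇒< q s qs))
  from : p ⊔ q < r ⊓ s → T (((p <ᵇ r) ∧ (p <ᵇ s)) ∧ ((q <ᵇ r) ∧ (q <ᵇ s)))
  from p⊔q<r⊓s = Equivalence.from T-∧
    ( Equivalence.from T-∧ (<⇒<ᵇ (m⊔n<o⇒m<o p q p⊔q<r) , <⇒<ᵇ (m⊔n<o⇒m<o p q p⊔q<s))
    , Equivalence.from T-∧ (<⇒<ᵇ (m⊔n<o⇒n<o p q p⊔q<r) , <⇒<ᵇ (m⊔n<o⇒n<o p q p⊔q<s)))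
    where
    p⊔q<r = m<n⊓o⇒m<n r s p⊔q<r⊓s
    p⊔q<s = m<n⊓o⇒m<o r s p⊔q<r⊓s

-- Truth values of p < q, q < r and p < r: transitivity rules out the two cyclic patterns.
Transitive₃ : Bool → Bool → Bool → Bool
Transitive₃ pq qr pr = not (pq ∧ qr ∧ not pr) ∧ not (not pq ∧ not qr ∧ pr)

transitive₃ : ∀ p q r → T (Transitive₃ (p <ᵇ q) (q <ᵇ r) (p <ᵇ r))
transitive₃ p q r with p <ᵇ q in pq | q <ᵇ r in qr | p <ᵇ r in pr
... | true  | true  | true  = _
... | true  | true  | false = contradiction (<-trans (<ᵇ≡true⇒< p q pq) (<ᵇ≡true⇒< q r qr)) (<ᵇ≡false⇒≮ p r pr)
... | true  | false | _     = _
... | false | true  | _     = _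
... | false | false | true  = contradiction (<ᵇ≡true⇒< p r pr)
      (≤⇒≯ (≤-trans (≮⇒≥ (<ᵇ≡false⇒≮ q r qr)) (≮⇒≥ (<ᵇ≡false⇒≮ p q pq))))
... | false | false | false = _

separatedᵇ : ℕ → ℕ → ℕ → ℕ → Bool
separatedᵇ p q r s = (p ⊔ q <ᵇ r ⊓ s) ∨ (r ⊔ s <ᵇ p ⊓ q)

separatedᵇ-comm : ∀ p q r s → separatedᵇ p q r s ≡ separatedᵇ r s p q
separatedᵇ-comm p q r s = ∨-comm (p ⊔ q <ᵇ r ⊓ s) _

separatedᵇ-irrefl : ∀ p q → separatedᵇ p q p q ≡ false
separatedᵇ-irrefl p q rewrite ≮⇒<ᵇ≡false (≤⇒≯ (m⊓n≤m⊔n p q)) = refl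

separatedᵇ⇒≢ : ∀ p q r s → separatedᵇ p q r s ≡ true → (p ≢ r × p ≢ s) × (q ≢ r × q ≢ s)
separatedᵇ⇒≢ p q r s sep =
    ( (λ { refl → apart (m⊓n≤m p q) (m≤m⊔n p q) (m⊓n≤m r s) (m≤m⊔n r s) })
    , (λ { refl → apart (m⊓n≤m p q) (m≤m⊔n p q) (m⊓n≤n r s) (m≤n⊔m r s) }) )
  , ( (λ { refl → apart (m⊓n≤n p q) (m≤n⊔m p q) (m⊓n≤m r s) (m≤m⊔n r s) })
    , (λ { refl → apart (m⊓n≤n p q) (m≤n⊔m p q) (m⊓n≤n r s) (m≤n⊔m r s) }) )
  where
  apart : ∀ {t} → p ⊓ q ≤ t → t ≤ p ⊔ q → r ⊓ s ≤ t → t ≤ r ⊔ s → ⊥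
  apart lo₁≤t t≤hi₁ lo₂≤t t≤hi₂ with p ⊔ q <ᵇ r ⊓ s in eq
  ... | true  = <⇒≱ (<ᵇ≡true⇒< _ _ eq) (≤-trans lo₂≤t t≤hi₁)
  ... | false = <⇒≱ (<ᵇ≡true⇒< _ _ sep) (≤-trans lo₁≤t t≤hi₂)

-- Truth values of p < r, p < s, q < r and q < s: {p, q} and {r, s} lie on opposite sides.
Cross : Bool → Bool → Bool → Bool → Bool
Cross pr ps qr qs = ((pr ∧ ps) ∧ (qr ∧ qs)) ∨ ((not pr ∧ not qr) ∧ (not ps ∧ not qs))

separatedᵇ-cross : ∀ {p q r s} → p ≢ r → p ≢ s → q ≢ r → q ≢ s →
  separatedᵇ p q r s ≡ Cross (p <ᵇ r) (p <ᵇ s) (q <ᵇ r) (q <ᵇ s)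
separatedᵇ-cross {p} {q} {r} {s} p≢r p≢s q≢r q≢s
  rewrite ⊔<ᵇ⊓ p q r s | ⊔<ᵇ⊓ r s p q | <ᵇ-flip p≢r | <ᵇ-flip p≢s | <ᵇ-flip q≢r | <ᵇ-flip q≢s = refl

∀-Bool? : {P : Bool → Set} → (∀ b → Dec (P b)) → Dec (∀ b → P b)
∀-Bool? P? = map′ (λ (f , t) → λ { false → f ; true → t }) (λ p → p false , p true) (P? false ×-dec P? true)

-- A = p<q, B = p<r, C = p<s, D = q<r, E = q<s, F = r<s for four numbers p, q, r, s.
FourPointPattern : Bool → Bool → Bool → Bool → Bool → Bool → Set
FourPointPattern A B C D E F =
  T (Transitive₃ A D B) → T (Transitive₃ A E C) → T (Transitive₃ B F C) → T (Transitive₃ D F E) →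
  T (Cross B C D E ∨ Cross A C (not D) F ∨ Cross B A (not F) (not E))

four-point-pattern? : ∀ A B C D E F → Dec (FourPointPattern A B C D E F)
four-point-pattern? A B C D E F = T? _ →-dec T? _ →-dec T? _ →-dec T? _ →-dec T? _

-- All 64 patterns are checked by evaluation.
four-point-pattern : ∀ A B C D E F → FourPointPattern A B C D E F
four-point-pattern = from-yes
  (∀-Bool? λ A → ∀-Bool? λ B → ∀-Bool? λ C → ∀-Bool? λ D → ∀-Bool? λ E → ∀-Bool? λ F →
     four-point-pattern? A B C D E F)

some-pairing-separated : ∀ {p q r s} → p ≢ q → p ≢ r → p ≢ s → q ≢ r → q ≢ s → r ≢ s →
  T (separatedᵇ p q r s ∨ separatedᵇ p r q s ∨ separatedᵇ p s r q)
some-pairing-separated {p} {q} {r} {s} p≢q p≢r p≢s q≢r q≢s r≢s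
  rewrite separatedᵇ-cross p≢r p≢s q≢r q≢s
        | separatedᵇ-cross p≢q p≢s (q≢r ∘ sym) r≢s
        | separatedᵇ-cross p≢r p≢q (r≢s ∘ sym) (q≢s ∘ sym)
        | <ᵇ-flip q≢r | <ᵇ-flip q≢s | <ᵇ-flip r≢s
  = four-point-pattern (p <ᵇ q) (p <ᵇ r) (p <ᵇ s) (q <ᵇ r) (q <ᵇ s) (r <ᵇ s)
      (transitive₃ p q r) (transitive₃ p q s) (transitive₃ p r s) (transitive₃ q r s)

ℕ→ℚ : ℕ → ℚ
ℕ→ℚ m = fromℤ (ℤ.+ m)

ℕ→ℚ-mono-≤ : ∀ {m n} → m ≤ n → ℕ→ℚ m ≤ℚ ℕ→ℚ n
ℕ→ℚ-mono-≤ {m} {n} m≤n =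
  *≤* (subst₂ ℤ._≤_ (sym (ℤ.*-identityʳ (ℤ.+ m))) (sym (ℤ.*-identityʳ (ℤ.+ n))) (ℤ.+≤+ m≤n))

ℕ→ℚ-mono-< : ∀ {m n} → m < n → ℕ→ℚ m <ℚ ℕ→ℚ n
ℕ→ℚ-mono-< {m} {n} m<n =
  *<* (subst₂ ℤ._<_ (sym (ℤ.*-identityʳ (ℤ.+ m))) (sym (ℤ.*-identityʳ (ℤ.+ n))) (ℤ.+<+ m<n))

ℕ→ℚ-cancel-< : ∀ {m n} → ℕ→ℚ m <ℚ ℕ→ℚ n → m < n
ℕ→ℚ-cancel-< {m} {n} (*<* m<n) with subst₂ ℤ._<_ (ℤ.*-identityʳ (ℤ.+ m)) (ℤ.*-identityʳ (ℤ.+ n)) m<n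
... | ℤ.+<+ m<n = m<n

Apart : ∀ {n} → Fin n × Fin n → Fin n × Fin n → Set
Apart (a , b) (c , d) = (a ≢ c × a ≢ d) × (b ≢ c × b ≢ d)

module _ {n : ℕ} (ℓ : Fin n → ℕ) where

  pairSeparatedᵇ : Fin n × Fin n → Fin n × Fin n → Bool
  pairSeparatedᵇ (a , b) (c , d) = separatedᵇ (ℓ a) (ℓ b) (ℓ c) (ℓ d)

  labelInterval : Fin n × Fin n → Interval
  labelInterval (a , b) = record
    { lo    = ℕ→ℚ (ℓ a ⊓ ℓ b)
    ; hi    = ℕ→ℚ (ℓ a ⊔ ℓ b)
    ; lo≤hi = ℕ→ℚ-mono-≤ (m⊓n≤m⊔n (ℓ a) (ℓ b))
    }

  pairSeparatedᵇ-comm : ∀ ab cd → pairSeparatedᵇ ab cd ≡ pairSeparatedᵇ cd ab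
  pairSeparatedᵇ-comm (a , b) (c , d) = separatedᵇ-comm (ℓ a) (ℓ b) (ℓ c) (ℓ d)

  pairSeparatedᵇ-irrefl : ∀ ab → pairSeparatedᵇ ab ab ≡ false
  pairSeparatedᵇ-irrefl (a , b) = separatedᵇ-irrefl (ℓ a) (ℓ b)

  pairSeparatedᵇ⇔Disjoint : ∀ ab cd → pairSeparatedᵇ ab cd ≡ true ⇔ Disjoint (labelInterval ab) (labelInterval cd)
  pairSeparatedᵇ⇔Disjoint (a , b) (c , d) = mk⇔ to from
    where
    to : pairSeparatedᵇ (a , b) (c , d) ≡ true → Disjoint (labelInterval (a , b)) (labelInterval (c , d))
    to sep with ℓ a ⊔ ℓ b <ᵇ ℓ c ⊓ ℓ d in eq
    ... | true  = inj₁ (ℕ→ℚ-mono-< (<ᵇ≡true⇒< _ _ eq))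
    ... | false = inj₂ (ℕ→ℚ-mono-< (<ᵇ≡true⇒< _ _ sep))
    from : Disjoint (labelInterval (a , b)) (labelInterval (c , d)) → pairSeparatedᵇ (a , b) (c , d) ≡ true
    from (inj₁ hi<lo) rewrite <⇒<ᵇ≡true (ℕ→ℚ-cancel-< hi<lo) = refl
    from (inj₂ hi<lo) rewrite <⇒<ᵇ≡true (ℕ→ℚ-cancel-< hi<lo) = ∨-zeroʳ _

  pairSeparatedᵇ⇒Apart : ∀ ab cd → pairSeparatedᵇ ab cd ≡ true → Apart ab cd
  pairSeparatedᵇ⇒Apart (a , b) (c , d) sep
    with (p≢r , p≢s) , (q≢r , q≢s) ← separatedᵇ⇒≢ (ℓ a) (ℓ b) (ℓ c) (ℓ d) sep
    = (p≢r ∘ cong ℓ , p≢s ∘ cong ℓ) , (q≢r ∘ cong ℓ , q≢s ∘ cong ℓ)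

pairSeparatedᵇ-cong : ∀ {n} {ℓ ℓ′ : Fin n → ℕ} → ℓ ≗ ℓ′ → ∀ ab cd →
  pairSeparatedᵇ ℓ ab cd ≡ pairSeparatedᵇ ℓ′ ab cd
pairSeparatedᵇ-cong ℓ≗ℓ′ (a , b) (c , d) rewrite ℓ≗ℓ′ a | ℓ≗ℓ′ b | ℓ≗ℓ′ c | ℓ≗ℓ′ d = refl

module _ {n m : ℕ} where

  injectiveSeparatingᵇ : Fin n × Fin n → Fin n × Fin n → (Fin n → Fin m) → Bool
  injectiveSeparatingᵇ ab cd x = injectiveᵇ x ∧ pairSeparatedᵇ (toℕ ∘ x) ab cd

  #separatingInjections : Fin n × Fin n → Fin n × Fin n → ℕ
  #separatingInjections ab cd = sumMaps (⟦_⟧ ∘ injectiveSeparatingᵇ ab cd)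

  #separatingInjections-relabel : ∀ (π : Permutation′ n) {a b c d a′ b′ c′ d′} →
    π ⟨$⟩ʳ a ≡ a′ → π ⟨$⟩ʳ b ≡ b′ → π ⟨$⟩ʳ c ≡ c′ → π ⟨$⟩ʳ d ≡ d′ →
    #separatingInjections (a , b) (c , d) ≡ #separatingInjections (a′ , b′) (c′ , d′)
  #separatingInjections-relabel π {a} {b} {c} {d} refl refl refl refl = begin
    sumMaps (⟦_⟧ ∘ injectiveSeparatingᵇ (a , b) (c , d))
      ≡⟨ sumMaps-precompose π (⟦_⟧ ∘ injectiveSeparatingᵇ (a , b) (c , d)) (cong ⟦_⟧ ∘ separating-cong) ⟩
    sumMaps (λ x → ⟦ injectiveᵇ (x ∘ (π ⟨$⟩ʳ_)) ∧ pairSeparatedᵇ (toℕ ∘ x) ab′ cd′ ⟧)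
      ≡⟨ sumMaps-cong (λ x → cong (λ i → ⟦ i ∧ pairSeparatedᵇ (toℕ ∘ x) ab′ cd′ ⟧)
                                   (injectiveᵇ-precompose π x)) ⟩
    sumMaps (⟦_⟧ ∘ injectiveSeparatingᵇ ab′ cd′)
      ∎
    where
    open ≡-Reasoning
    ab′ cd′ : Fin n × Fin n
    ab′ = π ⟨$⟩ʳ a , π ⟨$⟩ʳ b
    cd′ = π ⟨$⟩ʳ c , π ⟨$⟩ʳ d
    separating-cong : Congruent _≗_ _≡_ (injectiveSeparatingᵇ (a , b) (c , d))
    separating-cong x≗y = cong₂ _∧_ (injectiveᵇ-cong x≗y) (pairSeparatedᵇ-cong (cong toℕ ∘ x≗y) (a , b) (c , d))

  #injections≤3*#separatingInjections : ∀ {a b c d} → a ≢ b → c ≢ d → Apart (a , b) (c , d) →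
    #injections n m ≤ 3 * #separatingInjections (a , b) (c , d)
  #injections≤3*#separatingInjections {a} {b} {c} {d} a≢b c≢d ((a≢c , a≢d) , (b≢c , b≢d)) = begin
    #injections n m                           ≤⟨ sumMaps-mono-≤ covered ⟩
    sumMaps (λ x → w₁ x + (w₂ x + w₃ x))      ≡⟨ sumMaps-+ w₁ (λ x → w₂ x + w₃ x) ⟩
    S₁ + sumMaps (λ x → w₂ x + w₃ x)          ≡⟨ cong (S₁ +_) (sumMaps-+ w₂ w₃) ⟩
    S₁ + (S₂ + S₃)                            ≡⟨ cong₂ (λ s t → S₁ + (s + t)) S₁≡S₂ S₁≡S₃ ⟨
    S₁ + (S₁ + S₁)                            ≡⟨ cong (λ t → S₁ + (S₁ + t)) (+-identityʳ S₁) ⟨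
    3 * S₁                                    ∎
    where
    open ≤-Reasoning
    w₁ w₂ w₃ : (Fin n → Fin m) → ℕ
    w₁ = ⟦_⟧ ∘ injectiveSeparatingᵇ (a , b) (c , d)
    w₂ = ⟦_⟧ ∘ injectiveSeparatingᵇ (a , c) (b , d)
    w₃ = ⟦_⟧ ∘ injectiveSeparatingᵇ (a , d) (c , b)
    S₁ S₂ S₃ : ℕ
    S₁ = sumMaps w₁
    S₂ = sumMaps w₂
    S₃ = sumMaps w₃

    covered : ∀ x → ⟦ injectiveᵇ x ⟧ ≤ w₁ x + (w₂ x + w₃ x)
    covered x = ⟦⟧≤⟦∧⟧+⟦∧⟧+⟦∧⟧ (injectiveᵇ x) λ inj → some-pairing-separated
      (label≢ inj a≢b) (label≢ inj a≢c) (label≢ inj a≢d) (label≢ inj b≢c) (label≢ inj b≢d) (label≢ inj c≢d)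
      where
      label≢ : T (injectiveᵇ x) → ∀ {i j} → i ≢ j → toℕ (x i) ≢ toℕ (x j)
      label≢ inj i≢j = i≢j ∘ T-does (injective? x) inj ∘ toℕ-injective

    S₁≡S₂ : S₁ ≡ S₂
    S₁≡S₂ = #separatingInjections-relabel (transpose b c)
      (transpose-other b c a≢b a≢c) (transpose-matchˡ b c) (transpose-matchʳ b c)
      (transpose-other b c (b≢d ∘ sym) (c≢d ∘ sym))

    S₁≡S₃ : S₁ ≡ S₃
    S₁≡S₃ = #separatingInjections-relabel (transpose b d)
      (transpose-other b d a≢b a≢d) (transpose-matchˡ b d) (transpose-other b d (b≢c ∘ sym) c≢d)
      (transpose-matchʳ b d)

-- The separation graph of a vertex labelling

module _ {n : ℕ} (G : Graph n) where

  coLineAdj⇔Apart : ∀ e f → coLineAdj G e f ≡ true ⇔ Apart (endpoints G e) (endpoints G f)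
  coLineAdj⇔Apart e f with endpoints G e | endpoints G f
  ... | a , b | c , d with a ≟ c | a ≟ d | b ≟ c | b ≟ d
  ... | no a≢c  | no a≢d  | no b≢c  | no b≢d  = mk⇔ (λ _ → (a≢c , a≢d) , (b≢c , b≢d)) (λ _ → refl)
  ... | yes a≡c | _       | _       | _       = mk⇔ (λ ()) (λ apart → contradiction a≡c (proj₁ (proj₁ apart)))
  ... | no _    | yes a≡d | _       | _       = mk⇔ (λ ()) (λ apart → contradiction a≡d (proj₂ (proj₁ apart)))
  ... | no _    | no _    | yes b≡c | _       = mk⇔ (λ ()) (λ apart → contradiction b≡c (proj₁ (proj₂ apart)))
  ... | no _    | no _    | no _    | yes b≡d = mk⇔ (λ ()) (λ apart → contradiction b≡d (proj₂ (proj₂ apart)))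

  endpoints-distinct : ∀ e → proj₁ (endpoints G e) ≢ proj₂ (endpoints G e)
  endpoints-distinct e a≡b = subst T (trans (cong (adj G _) (sym a≡b)) (irrefl G _)) adjacent
    where
    adjacent : T (adj G (proj₁ (endpoints G e)) (proj₂ (endpoints G e)))
    adjacent = All.lookup (all-filter (T? ∘ λ (a , b) → adj G a b) (pairs< n)) (∈-lookup e)

  separationGraph : (Fin n → ℕ) → Graph (LV G)
  separationGraph ℓ = record
    { adj    = λ e f → pairSeparatedᵇ ℓ (endpoints G e) (endpoints G f)
    ; sym    = λ e f → pairSeparatedᵇ-comm ℓ (endpoints G e) (endpoints G f)
    ; irrefl = λ e → pairSeparatedᵇ-irrefl ℓ (endpoints G e)
    }

  separationGraph-intervalOrder : ∀ ℓ → IsIntervalOrder (separationGraph ℓ)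
  separationGraph-intervalOrder ℓ = labelInterval ℓ ∘ endpoints G , λ e f _ → pairSeparatedᵇ⇔Disjoint ℓ _ _

  separationGraph-⊆coL : ∀ ℓ → SubCoL G (separationGraph ℓ)
  separationGraph-⊆coL ℓ e f sep = Equivalence.from (coLineAdj⇔Apart e f) (pairSeparatedᵇ⇒Apart ℓ _ _ sep)

-- Averaging over vertex orderings

adjPair : ∀ {m} → Graph m → Fin m × Fin m → Bool
adjPair A (e , f) = adj A e f

module _ {n : ℕ} (G : Graph n) (H : Graph (LV G)) (H⊆coL : SubCoL G H) where

  private
    F : (Fin n → Fin n) → Graph (LV G)
    F x = separationGraph G (toℕ ∘ x)

    common : (Fin n → Fin n) → Fin (LV G) × Fin (LV G) → Bool
    common x p = adjPair (F x) p ∧ adjPair H p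

  edge-bound : ∀ p → ⟦ adjPair H p ⟧ * #injections n n ≤ 3 * sumMaps (λ x → ⟦ injectiveᵇ x ∧ common x p ⟧)
  edge-bound (e , f) with adj H e f in e∼f
  ... | false = z≤n
  ... | true  = begin
    1 * #injections n n
      ≡⟨ +-identityʳ _ ⟩
    #injections n n
      ≤⟨ #injections≤3*#separatingInjections (endpoints-distinct G e) (endpoints-distinct G f)
           (Equivalence.to (coLineAdj⇔Apart G e f) (H⊆coL e f e∼f)) ⟩
    3 * #separatingInjections (endpoints G e) (endpoints G f)
      ≡⟨ cong (3 *_) (sumMaps-cong λ x → cong (λ b → ⟦ injectiveᵇ x ∧ b ⟧) (∧-identityʳ (adj (F x) e f))) ⟨
    3 * sumMaps (λ x → ⟦ injectiveᵇ x ∧ (adj (F x) e f ∧ true) ⟧)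
      ∎
    where open ≤-Reasoning

  ∣E∣*#injections≤∑3*commonEdges :
    ∣E∣ H * #injections n n ≤ sumMaps (λ x → ⟦ injectiveᵇ x ⟧ * (3 * commonEdges (F x) H))
  ∣E∣*#injections≤∑3*commonEdges = begin
    ∣E∣ H * N                                     ≡⟨ cong (_* N) (length-filterᵇ (adjPair H) P) ⟩
    (∑[ i < L ] ⟦ adjPair H (lookup P i) ⟧) * N   ≡⟨ *-distribʳ-sum N (⟦_⟧ ∘ adjPair H ∘ lookup P) ⟩
    ∑[ i < L ] (⟦ adjPair H (lookup P i) ⟧ * N)   ≤⟨ ∑-mono-≤ (edge-bound ∘ lookup P) ⟩
    ∑[ i < L ] (3 * sumMaps (λ x → t x i))        ≡⟨ *-distribˡ-sum 3 (λ i → sumMaps (λ x → t x i)) ⟨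
    3 * ∑[ i < L ] sumMaps (λ x → t x i)          ≡⟨ cong (3 *_) (∑-comm (λ i k → t (finToFun k) i)) ⟩
    3 * sumMaps (λ x → ∑[ i < L ] t x i)          ≡⟨ *-distribˡ-sum 3 (λ k → ∑[ i < L ] t (finToFun k) i) ⟩
    sumMaps (λ x → 3 * ∑[ i < L ] t x i)          ≡⟨ sumMaps-cong weighted-common ⟩
    sumMaps (λ x → ⟦ injectiveᵇ x ⟧ * (3 * commonEdges (F x) H)) ∎
    where
    open ≤-Reasoning
    N = #injections n n
    P = pairs< (LV G)
    L = length P
    t : (Fin n → Fin n) → Fin L → ℕ
    t x i = ⟦ injectiveᵇ x ∧ common x (lookup P i) ⟧
    weighted-common : ∀ x → 3 * ∑[ i < L ] t x i ≡ ⟦ injectiveᵇ x ⟧ * (3 * commonEdges (F x) H)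
    weighted-common x = begin-equality
      3 * ∑[ i < L ] t x i
        ≡⟨ cong (3 *_) (sum-cong-≗ (λ i → ⟦∧⟧ (injectiveᵇ x) (common x (lookup P i)))) ⟩
      3 * ∑[ i < L ] (⟦ injectiveᵇ x ⟧ * ⟦ common x (lookup P i) ⟧)
        ≡⟨ cong (3 *_) (*-distribˡ-sum ⟦ injectiveᵇ x ⟧ (⟦_⟧ ∘ common x ∘ lookup P)) ⟨
      3 * (⟦ injectiveᵇ x ⟧ * ∑[ i < L ] ⟦ common x (lookup P i) ⟧)
        ≡⟨ x∙yz≈y∙xz 3 ⟦ injectiveᵇ x ⟧ _ ⟩
      ⟦ injectiveᵇ x ⟧ * (3 * ∑[ i < L ] ⟦ common x (lookup P i) ⟧)
        ≡⟨ cong (λ c → ⟦ injectiveᵇ x ⟧ * (3 * c)) (length-filterᵇ (common x) P) ⟨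
      ⟦ injectiveᵇ x ⟧ * (3 * commonEdges (F x) H)
        ∎

  -- A with-abstraction here would normalise ∣E∣ H while abstracting; hence the helper.
  third-keeping-labelling : ∃[ x ] ∣E∣ H ≤ 3 * commonEdges (F x) H
  third-keeping-labelling = relabel (∑-weighted-≤⇒∃≤ (⟦_⟧ ∘ injectiveᵇ ∘ decode)
    (λ k → 3 * commonEdges (F (decode k)) H) (0<#injections n) ∣E∣*#injections≤∑3*commonEdges)
    where
    decode : Fin (n ^ n) → Fin n → Fin n
    decode = finToFun
    relabel : ∃[ k ] ∣E∣ H ≤ 3 * commonEdges (F (decode k)) H → ∃[ x ] ∣E∣ H ≤ 3 * commonEdges (F x) H
    relabel (k , bound) = decode k , bound

lemma13 : {n : ℕ} (G : Graph n) (H : Graph (LV G)) → SubCoL G H →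
    Σ (Graph (LV G)) (λ F → SubCoL G F × IsIntervalOrder F × ∣E∣ H ≤ 3 * commonEdges F H)
lemma13 G H H⊆coL =
  let x , bound = third-keeping-labelling G H H⊆coL
      ℓ = toℕ ∘ x
  in separationGraph G ℓ , separationGraph-⊆coL G ℓ , separationGraph-intervalOrder G ℓ , bound
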